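{- Let $d>1$ be an integer and, for each positive integer $n$, let $a_n = 2^{2^n}+d$. Then for every positive integer $m$ there exist two distinct positive integers $k \neq l$ such that $\gcd(a_k,a_l) > m$. -}

module Defs where

open import Data.Nat using (ℕ; _+_; _^_)

a : ℕ → ℕ → ℕ
a d n = 2 ^ (2 ^ n) + d

module Submission where

-- Write d = 2^e·d' with d' odd. Call G "good at level N" if 2^(2^N·q) ≡ 1 (mod G) for
-- some odd q. If such a G divides a_N, then, taking E > 0 with 2^E ≡ 1 (mod q), we get
-- 2^(2^(N+E)) ≡ 2^(2^N) (mod G), so G also divides a_(N+E); hence it suffices to find a
-- good divisor G > m of some a_N (large-gcd).
--
-- If d' > 1, choose N with a_N = 2^e·O,
-- O ≡ d' (mod 2^(N+1)); the good part G of O is congruent to d' and cannot equal d',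
-- so it is large (odd-part-case). If d = 2^e, choose k with a_k = 2^e·(1 + 2^A) where
-- 1 + 2^A is itself good at level k (power-of-two-case).

open import Defs
open import Data.Nat using (ℕ; _<_)
open import Data.Nat.GCD using (gcd)
open import Data.Product using (∃₂; _×_)
open import Relation.Binary.PropositionalEquality using (_≢_)

open import Data.Nat
open import Data.Nat.Properties
open import Data.Nat.Divisibility
open import Data.Nat.DivMod using (_%_; [m+kn]%n≡m%n; m<n⇒m%n≡m; m*[n/m]≡n)
open import Data.Nat.GCD using (gcd-greatest; gcd[m,n]≢0)
open import Data.Nat.Primality using (Prime; euclidsLemma; prime⇒nonTrivial)
open import Data.Nat.Primality.Factorisation using (factorise)
open import Data.Nat.Combinatorics
  using (_C_; nCk≡n!/k![n-k]!; k![n∸k]!∣n!; k>n⇒nCk≡0; nCn≡1; nCk+nC[k+1]≡[n+1]C[k+1])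
open import Data.Nat.ListAction using (product)
open import Data.Nat.Induction using (<-wellFounded)
open import Data.Nat.Tactic.RingSolver using (solve-∀)
open import Data.List using ([]; _∷_)
open import Data.List.Relation.Unary.All using (All; []; _∷_)
open import Data.Product using (∃; _,_; proj₁; proj₂)
open import Data.Sum using (_⊎_; inj₁; inj₂)
open import Data.Empty using (⊥-elim)
open import Induction.WellFounded using (Acc; acc)
open import Relation.Nullary using (¬_; yes; no)
open import Relation.Binary.PropositionalEquality
  using (_≡_; refl; sym; trans; cong; cong₂; subst; module ≡-Reasoning)

infix 4 _≡1[mod_]

record _≡1[mod_] (x M : ℕ) : Set where
  constructor _,_
  field
    quotient : ℕ
    equation : x ≡ 1 + M * quotient

≡1-one : ∀ M → 1 ≡1[mod M ]
≡1-one M = 0 , cong suc (sym (*-zeroʳ M))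

≡1-* : ∀ {M x y} → x ≡1[mod M ] → y ≡1[mod M ] → x * y ≡1[mod M ]
≡1-* {M} (q , refl) (r , refl) = q + r + M * q * r , expand M q r
  where
  expand : ∀ M q r → (1 + M * q) * (1 + M * r) ≡ 1 + M * (q + r + M * q * r)
  expand = solve-∀

≡1-^ : ∀ {M x} → x ≡1[mod M ] → ∀ c → x ^ c ≡1[mod M ]
≡1-^ {M} _   zero    = ≡1-one M
≡1-^     x≡1 (suc c) = ≡1-* x≡1 (≡1-^ x≡1 c)

≡1-≤ : ∀ {M x} → x ≡1[mod M ] → x ≤ M → x ≡ 1
≡1-≤ {M} (zero  , refl) _   = cong suc (*-zeroʳ M)
≡1-≤ {M} (suc q , refl) x≤M = ⊥-elim (<⇒≱ (s≤s (m≤m*n M (suc q))) x≤M)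

-- Second-order binomial expansion: if p ∣ y then (1 + y)^c ≡ 1 + c·y (mod y·p),
-- because every higher term contains y² and p ∣ y.
binomial-mod : ∀ {y p} → p ∣ y → ∀ c → ∃ λ h → (1 + y) ^ c ≡ 1 + c * y + y * p * h
binomial-mod {p = p} (divides b refl) = expansion
  where
  expansion : ∀ c → ∃ λ h → (1 + b * p) ^ c ≡ 1 + c * (b * p) + b * p * p * h
  expansion zero    = 0 , base b p
    where
    base : ∀ b p → 1 ≡ 1 + 0 * (b * p) + b * p * p * 0
    base = solve-∀
  expansion (suc c) with expansion c
  ... | h , eq = c * b + h + b * p * h , (begin
      (1 + b * p) * (1 + b * p) ^ c                              ≡⟨ cong ((1 + b * p) *_) eq ⟩
      (1 + b * p) * (1 + c * (b * p) + b * p * p * h)            ≡⟨ step b p c h ⟩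
      1 + suc c * (b * p) + b * p * p * (c * b + h + b * p * h)  ∎)
    where
    open ≡-Reasoning
    step : ∀ b p c h → (1 + b * p) * (1 + c * (b * p) + b * p * p * h)
                     ≡ 1 + suc c * (b * p) + b * p * p * (c * b + h + b * p * h)
    step = solve-∀

-- Lifting: if x ≡ 1 modulo both G and p, then x^p ≡ 1 (mod G·p).
-- (This is what allows a prime to occur in G with multiplicity.)
≡1-lift : ∀ {G p x} → x ≡1[mod G ] → x ≡1[mod p ] → x ^ p ≡1[mod G * p ]
≡1-lift {G} {p} (a , refl) (b , Ga≡pb) = a * (1 + h) , (begin
    (1 + G * a) ^ p                  ≡⟨ expansion ⟩
    1 + p * (G * a) + G * a * p * h  ≡⟨ regroup G a p h ⟩
    1 + G * p * (a * (1 + h))        ∎)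
  where
  open ≡-Reasoning
  p∣Ga : p ∣ G * a
  p∣Ga = divides b (trans (suc-injective Ga≡pb) (*-comm p b))
  h : ℕ
  h = proj₁ (binomial-mod p∣Ga p)
  expansion : (1 + G * a) ^ p ≡ 1 + p * (G * a) + G * a * p * h
  expansion = proj₂ (binomial-mod p∣Ga p)
  regroup : ∀ G a p h → 1 + p * (G * a) + G * a * p * h ≡ 1 + G * p * (a * (1 + h))
  regroup = solve-∀

Odd : ℕ → Set
Odd x = ∃ λ y → x ≡ 1 + 2 * y

even-or-odd : ∀ x → (∃ λ y → x ≡ 2 * y) ⊎ Odd x
even-or-odd zero = inj₁ (0 , refl)
even-or-odd (suc x) with even-or-odd x
... | inj₁ (y , refl) = inj₂ (y , refl)
... | inj₂ (y , refl) = inj₁ (suc y , sym (*-suc 2 y))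

odd≢even : ∀ {x} → Odd x → ∀ y → x ≢ 2 * y
odd≢even (z , refl) y eq = even≢odd y z (sym eq)

odd-* : ∀ {x y} → Odd x → Odd y → Odd (x * y)
odd-* (a , refl) (b , refl) = a + b + 2 * a * b , expand a b
  where
  expand : ∀ a b → (1 + 2 * a) * (1 + 2 * b) ≡ 1 + 2 * (a + b + 2 * a * b)
  expand = solve-∀

odd-+-even : ∀ {x} → Odd x → ∀ y → Odd (x + 2 * y)
odd-+-even (a , refl) y = a + y , cong suc (sym (*-distribˡ-+ 2 a y))

odd-factorˡ : ∀ x y → Odd (x * y) → Odd x
odd-factorˡ x y oxy with even-or-odd x
... | inj₂ ox          = ox
... | inj₁ (z , refl) = ⊥-elim (odd≢even oxy (z * y) (*-assoc 2 z y))

odd-factorʳ : ∀ x y → Odd (x * y) → Odd y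
odd-factorʳ x y oxy = odd-factorˡ y x (subst Odd (*-comm x y) oxy)

two-adic : ∀ x → 0 < x → ∃₂ λ s u → x ≡ 2 ^ s * (1 + 2 * u)
two-adic x = go x (<-wellFounded x)
  where
  go : ∀ x → Acc _<_ x → 0 < x → ∃₂ λ s u → x ≡ 2 ^ s * (1 + 2 * u)
  go x (acc smaller) 0<x with even-or-odd x
  ... | inj₂ (u , refl)     = 0 , u , sym (+-identityʳ _)
  ... | inj₁ (zero , refl)  = ⊥-elim (<-irrefl refl 0<x)
  ... | inj₁ (suc y , refl) with go (suc y) (smaller (m<m+n (suc y) z<s)) z<s
  ...   | s , u , eq = suc s , u , trans (cong (2 *_) eq) (sym (*-assoc 2 (2 ^ s) _))

odd∣2^⇒≡1 : ∀ k {q} → Odd q → q ∣ 2 ^ k → q ≡ 1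
odd∣2^⇒≡1 zero    _  q∣1 = ∣1⇒≡1 q∣1
odd∣2^⇒≡1 (suc k) {q} oq (divides c 2^k+1≡cq) with even-or-odd c
... | inj₂ oc          = ⊥-elim (odd≢even (odd-* oc oq) (2 ^ k) (sym 2^k+1≡cq))
... | inj₁ (c' , refl) = odd∣2^⇒≡1 k oq
      (divides c' (*-cancelˡ-≡ _ _ 2 (trans 2^k+1≡cq (*-assoc 2 c' q))))

n<2^n : ∀ n → n < 2 ^ n
n<2^n zero    = z<s
n<2^n (suc n) = begin-strict
  suc n           <⟨ s≤s (n<2^n n) ⟩
  1 + 2 ^ n       ≡⟨ +-comm 1 (2 ^ n) ⟩
  2 ^ n + 1       ≤⟨ +-monoʳ-≤ (2 ^ n) (m^n>0 2 n) ⟩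
  2 ^ n + 2 ^ n   ≡⟨ cong (2 ^ n +_) (sym (+-identityʳ (2 ^ n))) ⟩
  2 * 2 ^ n       ∎
  where open ≤-Reasoning

prime>1 : ∀ {p} → Prime p → 1 < p
prime>1 pr = nonTrivial⇒n>1 _ {{prime⇒nonTrivial pr}}

prime∤! : ∀ {p} → Prime p → ∀ j → j < p → ¬ p ∣ j !
prime∤! pr zero    _   p∣1 = <-irrefl (sym (∣1⇒≡1 p∣1)) (prime>1 pr)
prime∤! pr (suc j) j<p p∣j! with euclidsLemma (suc j) (j !) pr p∣j!
... | inj₁ p∣1+j = <⇒≱ j<p (∣⇒≤ p∣1+j)
... | inj₂ p∣j!′ = prime∤! pr j (<-trans (n<1+n j) j<p) p∣j!′

p∣p! : ∀ {p} → 0 < p → p ∣ p !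
p∣p! {suc p} _ = m∣m*n (p !)

C*factorials : ∀ n k → k ≤ n → k ! * (n ∸ k) ! * (n C k) ≡ n !
C*factorials n k k≤n =
  trans (cong (k ! * (n ∸ k) ! *_) (nCk≡n!/k![n-k]! k≤n))
        (m*[n/m]≡n {{k !* (n ∸ k) !≢0}} (k![n∸k]!∣n! k≤n))

-- A prime p divides (p choose k) for 0 < k < p: it divides p! but neither k! nor (p − k)!.
prime∣C : ∀ {p k} → Prime p → 0 < k → k < p → p ∣ p C k
prime∣C {p} {k} pr 0<k k<p
  with euclidsLemma (k ! * (p ∸ k) !) (p C k) pr
         (subst (p ∣_) (sym (C*factorials p k (<⇒≤ k<p))) (p∣p! (<-trans z<s (prime>1 pr))))
... | inj₂ p∣C = p∣C
... | inj₁ p∣k![p-k]! with euclidsLemma (k !) ((p ∸ k) !) pr p∣k![p-k]!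
...   | inj₁ p∣k!     = ⊥-elim (prime∤! pr k k<p p∣k!)
...   | inj₂ p∣[p-k]! = ⊥-elim (prime∤! pr (p ∸ k) (∸-monoʳ-< 0<k (<⇒≤ k<p)) p∣[p-k]!)

rowSum : ℕ → ℕ → ℕ
rowSum n zero    = 0
rowSum n (suc N) = rowSum n N + n C N

rowSum-pascal : ∀ n N → rowSum (suc n) (suc N) ≡ rowSum n (suc N) + rowSum n N
rowSum-pascal n zero    = refl
rowSum-pascal n (suc N) = begin
  rowSum (suc n) (suc N) + suc n C suc N
    ≡⟨ cong₂ _+_ (rowSum-pascal n N) (sym (nCk+nC[k+1]≡[n+1]C[k+1] n N)) ⟩
  (rowSum n N + n C N + rowSum n N) + (n C N + n C suc N)
    ≡⟨ regroup (rowSum n N) (n C N) (n C suc N) ⟩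
  (rowSum n N + n C N + n C suc N) + (rowSum n N + n C N) ∎
  where
  open ≡-Reasoning
  regroup : ∀ a b c → (a + b + a) + (b + c) ≡ (a + b + c) + (a + b)
  regroup = solve-∀

rowSum-full : ∀ n → rowSum n (suc n) ≡ 2 ^ n
rowSum-full zero    = refl
rowSum-full (suc n) = begin
  rowSum (suc n) (suc (suc n))                      ≡⟨ rowSum-pascal n (suc n) ⟩
  rowSum n (suc n) + n C suc n + rowSum n (suc n)   ≡⟨ cong (λ z → rowSum n (suc n) + z + rowSum n (suc n))
                                                           (k>n⇒nCk≡0 (n<1+n n)) ⟩
  rowSum n (suc n) + 0 + rowSum n (suc n)           ≡⟨ cong (λ z → z + 0 + z) (rowSum-full n) ⟩
  2 ^ n + 0 + 2 ^ n                                 ≡⟨ double (2 ^ n) ⟩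
  2 * 2 ^ n                                         ∎
  where
  open ≡-Reasoning
  double : ∀ x → x + 0 + x ≡ 2 * x
  double = solve-∀

-- Modulo a prime p, the entries 0 < k < p of row p vanish, so the partial sums are ≡ 1.
rowSum-prime : ∀ {p} → Prime p → ∀ N → N < p → rowSum p (suc N) ≡1[mod p ]
rowSum-prime {p} pr zero    _   = ≡1-one p
rowSum-prime {p} pr (suc N) N<p with rowSum-prime pr N (<-trans (n<1+n N) N<p)
... | w , sum≡ with prime∣C pr z<s N<p
...   | divides q C≡ = w + q , (begin
  rowSum p (suc N) + p C suc N ≡⟨ cong₂ _+_ sum≡ C≡ ⟩
  1 + p * w + q * p            ≡⟨ regroup p w q ⟩
  1 + p * (w + q)              ∎)
  where
  open ≡-Reasoning
  regroup : ∀ p w q → 1 + p * w + q * p ≡ 1 + p * (w + q)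
  regroup = solve-∀

fermat₂ : ∀ {p} → Prime p → ∃ λ w → 2 ^ p ≡ 2 + p * w
fermat₂ {zero}  pr with () ← prime>1 pr
fermat₂ {suc p} pr with rowSum-prime pr p ≤-refl
... | w , sum≡ = w , (begin
  2 ^ suc p                                  ≡⟨ sym (rowSum-full (suc p)) ⟩
  rowSum (suc p) (suc p) + suc p C suc p     ≡⟨ cong₂ _+_ sum≡ (nCn≡1 (suc p)) ⟩
  1 + suc p * w + 1                          ≡⟨ +-comm (1 + suc p * w) 1 ⟩
  2 + suc p * w                              ∎)
  where open ≡-Reasoning

fermat₂-odd : ∀ t → Prime (1 + 2 * t) → 2 ^ (2 * t) ≡1[mod 1 + 2 * t ]
fermat₂-odd t pr with fermat₂ pr
... | w , 2^p≡ with even-or-odd w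
...   | inj₂ ow          = ⊥-elim (odd≢even (odd-+-even (odd-* (t , refl) ow) 1) (2 ^ (2 * t))
                                   (trans (+-comm _ 2) (sym 2^p≡)))
...   | inj₁ (v , refl) = v , *-cancelˡ-≡ _ _ 2 (trans 2^p≡ (halve (1 + 2 * t) v))
  where
  halve : ∀ p v → 2 + p * (2 * v) ≡ 2 * (1 + p * v)
  halve = solve-∀

≡1-exponent : ∀ {e f M} → e ≡ f → 2 ^ e ≡1[mod M ] → 2 ^ f ≡1[mod M ]
≡1-exponent {M = M} e≡f = subst (λ e → 2 ^ e ≡1[mod M ]) e≡f

≡1-exponent-* : ∀ {M} e r → 2 ^ e ≡1[mod M ] → 2 ^ (e * r) ≡1[mod M ]
≡1-exponent-* {M} e r c = subst (_≡1[mod M ]) (^-*-assoc 2 e r) (≡1-^ c r)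

-- G is good at level n if 2^(2^n·q) ≡ 1 (mod G) for some odd q, i.e. the order of 2
-- modulo G divides 2^n times an odd number.
Good : ℕ → ℕ → Set
Good n G = ∃ λ q → Odd q × 2 ^ (2 ^ n * q) ≡1[mod G ]

-- Goodness persists at higher levels (raise to the power 2^(n − s)).
good-mono : ∀ {s n G q} → s ≤ n → Odd q → 2 ^ (2 ^ s * q) ≡1[mod G ] → Good n G
good-mono {s} {n} {G} {q} s≤n oq c =
  q , oq , ≡1-exponent exponent (≡1-exponent-* (2 ^ s * q) (2 ^ (n ∸ s)) c)
  where
  open ≡-Reasoning
  swap : ∀ a q b → a * q * b ≡ a * b * q
  swap = solve-∀
  exponent : 2 ^ s * q * 2 ^ (n ∸ s) ≡ 2 ^ n * q
  exponent = begin
    2 ^ s * q * 2 ^ (n ∸ s)   ≡⟨ swap (2 ^ s) q (2 ^ (n ∸ s)) ⟩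
    2 ^ s * 2 ^ (n ∸ s) * q   ≡⟨ cong (_* q) (sym (^-distribˡ-+-* 2 s (n ∸ s))) ⟩
    2 ^ (s + (n ∸ s)) * q     ≡⟨ cong (λ z → 2 ^ z * q) (m+[n∸m]≡n s≤n) ⟩
    2 ^ n * q                 ∎

good-one : ∀ n → Good n 1
good-one n = 1 , (0 , refl) , ≡1-mod-one (m^n>0 2 (2 ^ n * 1))
  where
  ≡1-mod-one : ∀ {x} → 0 < x → x ≡1[mod 1 ]
  ≡1-mod-one {suc x} _ = x , cong suc (sym (*-identityˡ x))

good-* : ∀ {n G H} → Good n G → Good n H → Odd H → Good n (G * H)
good-* {n} {G} {H} (q , oq , cG) (r , or , cH) oH =
  q * r * H , odd-* (odd-* oq or) oH , ≡1-exponent regroupᴴ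
    (subst (_≡1[mod G * H ]) (^-*-assoc 2 (2 ^ n * (q * r)) H) (≡1-lift inG inH))
  where
  assoc : ∀ a q r → a * q * r ≡ a * (q * r)
  assoc = solve-∀
  comm : ∀ a r q → a * r * q ≡ a * (q * r)
  comm = solve-∀
  regroupᴴ : 2 ^ n * (q * r) * H ≡ 2 ^ n * (q * r * H)
  regroupᴴ = assoc (2 ^ n) (q * r) H
  inG : 2 ^ (2 ^ n * (q * r)) ≡1[mod G ]
  inG = ≡1-exponent (assoc (2 ^ n) q r) (≡1-exponent-* (2 ^ n * q) r cG)
  inH : 2 ^ (2 ^ n * (q * r)) ≡1[mod H ]
  inH = ≡1-exponent (comm (2 ^ n) r q) (≡1-exponent-* (2 ^ n * r) q cH)

-- Write p − 1 = 2^s·(odd). An odd prime p is good at level n if s ≤ n (by Fermat),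
-- and otherwise p ≡ 1 (mod 2^(n+1)).
prime-dichotomy : ∀ n {p} → Prime p → Odd p → Good n p ⊎ p ≡1[mod 2 ^ suc n ]
prime-dichotomy n pr (zero , refl) = ⊥-elim (<-irrefl refl (prime>1 pr))
prime-dichotomy n pr (suc t , refl) with two-adic (2 * suc t) z<s
... | s , u , 2t≡ with s ≤? n
...   | yes s≤n = inj₁ (good-mono s≤n (u , refl) (≡1-exponent 2t≡ (fermat₂-odd (suc t) pr)))
...   | no  s≰n = inj₂ (2 ^ r * (1 + 2 * u) , cong suc (begin
  2 * suc t                         ≡⟨ 2t≡ ⟩
  2 ^ s * (1 + 2 * u)               ≡⟨ cong (λ z → 2 ^ z * (1 + 2 * u)) (sym (m+[n∸m]≡n (≰⇒> s≰n))) ⟩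
  2 ^ (suc n + r) * (1 + 2 * u)     ≡⟨ cong (_* (1 + 2 * u)) (^-distribˡ-+-* 2 (suc n) r) ⟩
  2 ^ suc n * 2 ^ r * (1 + 2 * u)   ≡⟨ *-assoc (2 ^ suc n) (2 ^ r) (1 + 2 * u) ⟩
  2 ^ suc n * (2 ^ r * (1 + 2 * u)) ∎))
  where
  open ≡-Reasoning
  r = s ∸ suc n

GoodSplit : ℕ → ℕ → Set
GoodSplit n O = ∃₂ λ G B → O ≡ G * B × Good n G × B ≡1[mod 2 ^ suc n ]

-- Every odd number has such a splitting: sort its prime factors by prime-dichotomy.
good-split : ∀ n {O} → Odd O → GoodSplit n O
good-split n (y , refl) with factorise (1 + 2 * y)
... | record { factors = ps ; isFactorisation = O≡∏ ; factorsPrime = prs } =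
  subst (GoodSplit n) (sym O≡∏) (split ps prs (subst Odd O≡∏ (y , refl)))
  where
  regroupᴳ : ∀ p G B → p * (G * B) ≡ G * p * B
  regroupᴳ = solve-∀
  regroupᴮ : ∀ p G B → p * (G * B) ≡ G * (p * B)
  regroupᴮ = solve-∀
  split : ∀ ps → All Prime ps → Odd (product ps) → GoodSplit n (product ps)
  split []       []         _   = 1 , 1 , refl , good-one n , ≡1-one _
  split (p ∷ ps) (pr ∷ prs) odd with split ps prs (odd-factorʳ p _ odd)
  ... | G , B , ∏≡GB , goodG , B≡1 with prime-dichotomy n pr (odd-factorˡ p _ odd)
  ...   | inj₁ goodp = G * p , B , trans (cong (p *_) ∏≡GB) (regroupᴳ p G B) ,
                       good-* {n} goodG goodp (odd-factorˡ p _ odd) , B≡1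
  ...   | inj₂ p≡1  = G , p * B , trans (cong (p *_) ∏≡GB) (regroupᴮ p G B) , goodG , ≡1-* p≡1 B≡1

-- Every odd O divides 2^E − 1 for some E > 0: split O at a level n with 2^(n+1) > O,
-- where the factor B ≡ 1 (mod 2^(n+1)) must be 1.
order : ∀ {O} → Odd O → ∃ λ E → 0 < E × 2 ^ E ≡1[mod O ]
order {O} oO@(y , refl) with good-split O oO
... | G , B , O≡GB , (q , (z , refl) , cG) , B≡1 =
  2 ^ O * (1 + 2 * z) , E>0 , subst (_ ≡1[mod_]) G≡O cG
  where
  B≤2^O : B ≤ 2 ^ suc O
  B≤2^O = ≤-trans (∣⇒≤ (divides G O≡GB))
                  (<⇒≤ (<-trans (n<1+n O) (n<2^n (suc O))))
  G≡O : G ≡ O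
  G≡O = sym (trans O≡GB (trans (cong (G *_) (≡1-≤ B≡1 B≤2^O)) (*-identityʳ G)))
  E>0 : 0 < 2 ^ O * (1 + 2 * z)
  E>0 = <-≤-trans z<s (m≤n*m (1 + 2 * z) (2 ^ O) {{m^n≢0 2 O}})

a-pos : ∀ d n → 0 < a d n
a-pos d n = <-≤-trans (m^n>0 2 (2 ^ n)) (m≤m+n _ d)

-- A divisor G of a_N that is good at level N divides a later term a_(N+E):
-- if 2^E ≡ 1 modulo the odd part q of the exponent, then 2^(2^(N+E)) ≡ 2^(2^N) (mod G).
good-divisor-recurs : ∀ d N {G} → Good N G → G ∣ a d N → ∃ λ E → 0 < E × G ∣ a d (N + E)
good-divisor-recurs d N {G} (q , oq , cG) G∣aN with order oq
... | E , E>0 , (v , 2^E≡) with ≡1-exponent-* (2 ^ N * q) v cG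
...   | w , power≡ = E , E>0 , subst (G ∣_) (sym aN+E≡) (∣m∣n⇒∣m+n G∣aN (n∣m*n (X * w)))
  where
  open ≡-Reasoning
  X = 2 ^ (2 ^ N)
  distribute : ∀ x q v → x * (1 + q * v) ≡ x + x * q * v
  distribute = solve-∀
  expand : ∀ X d G w → X * (1 + G * w) + d ≡ X + d + X * w * G
  expand = solve-∀
  aN+E≡ : a d (N + E) ≡ a d N + X * w * G
  aN+E≡ = begin
    2 ^ (2 ^ (N + E)) + d              ≡⟨ cong (λ z → 2 ^ z + d) (^-distribˡ-+-* 2 N E) ⟩
    2 ^ (2 ^ N * 2 ^ E) + d            ≡⟨ cong (λ z → 2 ^ (2 ^ N * z) + d) 2^E≡ ⟩
    2 ^ (2 ^ N * (1 + q * v)) + d      ≡⟨ cong (λ z → 2 ^ z + d) (distribute (2 ^ N) q v) ⟩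
    2 ^ (2 ^ N + 2 ^ N * q * v) + d    ≡⟨ cong (_+ d) (^-distribˡ-+-* 2 (2 ^ N) (2 ^ N * q * v)) ⟩
    X * 2 ^ (2 ^ N * q * v) + d        ≡⟨ cong (λ z → X * z + d) power≡ ⟩
    X * (1 + G * w) + d                ≡⟨ expand X d G w ⟩
    a d N + X * w * G                  ∎

record LargeGoodDivisor (d m : ℕ) : Set where
  field
    N    : ℕ
    G    : ℕ
    0<N  : 0 < N
    good : Good N G
    G∣aN : G ∣ a d N
    m<G  : m < G

large-gcd : ∀ {d m} → LargeGoodDivisor d m →
  ∃₂ λ k l → 0 < k × 0 < l × k ≢ l × m < gcd (a d k) (a d l)
large-gcd {d} record { N = N ; G = G ; 0<N = 0<N ; good = good ; G∣aN = G∣aN ; m<G = m<G }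
  with good-divisor-recurs d N good G∣aN
... | E , E>0 , G∣aN+E =
  N , N + E , 0<N , <-≤-trans 0<N (m≤m+n N E) , <⇒≢ (m<m+n N E>0) , <-≤-trans m<G G≤gcd
  where
  instance
    gcd≢0 : NonZero (gcd (a d N) (a d (N + E)))
    gcd≢0 = ≢-nonZero (gcd[m,n]≢0 _ _ (inj₁ (m<n⇒n≢0 (a-pos d N))))
  G≤gcd : G ≤ gcd (a d N) (a d (N + E))
  G≤gcd = ∣⇒≤ (gcd-greatest G∣aN G∣aN+E)

a-factor : ∀ e d' N x → 2 ^ N ≡ e + x → a (2 ^ e * d') N ≡ 2 ^ e * (d' + 2 ^ x)
a-factor e d' N x 2^N≡ = begin
  2 ^ (2 ^ N) + 2 ^ e * d'      ≡⟨ cong (λ z → 2 ^ z + 2 ^ e * d') 2^N≡ ⟩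
  2 ^ (e + x) + 2 ^ e * d'      ≡⟨ cong (_+ 2 ^ e * d') (^-distribˡ-+-* 2 e x) ⟩
  2 ^ e * 2 ^ x + 2 ^ e * d'    ≡⟨ sym (*-distribˡ-+ (2 ^ e) (2 ^ x) d') ⟩
  2 ^ e * (2 ^ x + d')          ≡⟨ cong (2 ^ e *_) (+-comm (2 ^ x) d') ⟩
  2 ^ e * (d' + 2 ^ x)          ∎
  where open ≡-Reasoning

-- For every e and c there is an index N > c with 2^N = e + (N + 1) + r for some r,
-- so that a_N = 2^e·(d' + 2^(N+1+r)) has odd part ≡ d' (mod 2^(N+1)).
aligned-index : ∀ e c → ∃₂ λ N r → c < N × 2 ^ N ≡ e + (suc N + r)
aligned-index e c = N , 2 ^ N ∸ (e + suc N) , s≤s (m≤n+m c e) , 2^N≡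
  where
  L = e + c
  N = suc L
  room : e + suc N ≤ 2 ^ N
  room = begin
    e + suc N      ≡⟨ +-suc e N ⟩
    suc e + N      ≤⟨ +-monoˡ-≤ N (s≤s (m≤m+n e c)) ⟩
    N + N          ≡⟨ cong (N +_) (sym (+-identityʳ N)) ⟩
    2 * N          ≤⟨ *-monoʳ-≤ 2 (n<2^n L) ⟩
    2 ^ N          ∎
    where open ≤-Reasoning
  2^N≡ : 2 ^ N ≡ e + (suc N + (2 ^ N ∸ (e + suc N)))
  2^N≡ = trans (sym (m+[n∸m]≡n room)) (+-assoc e (suc N) _)

residue-unique : ∀ {M x y u v} → x < M → y < M → x + M * u ≡ y + M * v → x ≡ y
residue-unique {suc M} {x} {y} {u} {v} x<M y<M eq = begin
  x                         ≡⟨ sym (m<n⇒m%n≡m x<M) ⟩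
  x % suc M                 ≡⟨ sym ([m+kn]%n≡m%n x u (suc M)) ⟩
  (x + u * suc M) % suc M   ≡⟨ cong (λ z → (x + z) % suc M) (*-comm u (suc M)) ⟩
  (x + suc M * u) % suc M   ≡⟨ cong (_% suc M) eq ⟩
  (y + suc M * v) % suc M   ≡⟨ cong (λ z → (y + z) % suc M) (*-comm (suc M) v) ⟩
  (y + v * suc M) % suc M   ≡⟨ [m+kn]%n≡m%n y v (suc M) ⟩
  y % suc M                 ≡⟨ m<n⇒m%n≡m y<M ⟩
  y                         ∎
  where open ≡-Reasoning

-- Let O = d' + 2^(s+r) with d' > 1 odd, and O = G·B with B ≡ 1 (mod 2^s).
-- Then G ≡ d' (mod 2^s); if G were small this would force G = d', so d' ∣ 2^(s+r),
-- which is impossible.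
good-part-large : ∀ {m d' s r G B} → Odd d' → 1 < d' → m + d' < 2 ^ s →
                  d' + 2 ^ (s + r) ≡ G * B → B ≡1[mod 2 ^ s ] → m < G
good-part-large {m} {d'} {s} {r} {G} od' 1<d' bound O≡GB (β , refl) with m <? G
... | yes m<G = m<G
... | no  m≮G = ⊥-elim (<-irrefl (sym (odd∣2^⇒≡1 (s + r) od' d'∣2^)) 1<d')
  where
  open ≡-Reasoning
  expand : ∀ G M β → G * (1 + M * β) ≡ G + M * (G * β)
  expand = solve-∀
  G≡d' : G ≡ d'
  G≡d' = residue-unique (≤-<-trans (≮⇒≥ m≮G) (≤-<-trans (m≤m+n m d') bound))
                        (≤-<-trans (m≤n+m d' m) bound)
           (begin
             G + 2 ^ s * (G * β)   ≡⟨ sym (expand G (2 ^ s) β) ⟩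
             G * (1 + 2 ^ s * β)   ≡⟨ sym O≡GB ⟩
             d' + 2 ^ (s + r)      ≡⟨ cong (d' +_) (^-distribˡ-+-* 2 s r) ⟩
             d' + 2 ^ s * 2 ^ r    ∎)
  d'∣O : d' ∣ d' + 2 ^ (s + r)
  d'∣O = subst (_∣ d' + 2 ^ (s + r)) G≡d' (divides (1 + 2 ^ s * β) (trans O≡GB (*-comm G _)))
  d'∣2^ : d' ∣ 2 ^ (s + r)
  d'∣2^ = ∣m+n∣m⇒∣n d'∣O ∣-refl

odd-part-case : ∀ {d e d'} → d ≡ 2 ^ e * d' → Odd d' → 1 < d' → ∀ m → LargeGoodDivisor d m
odd-part-case {e = e} {d'} refl od' 1<d' m with aligned-index e (m + d')
... | N , r , m+d'<N , 2^N≡ with good-split N (odd-+-even od' (2 ^ (N + r)))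
...   | G , B , O≡GB , good , B≡1 = record
  { N = N ; G = G ; 0<N = ≤-<-trans z≤n m+d'<N ; good = good ; G∣aN = G∣aN
  ; m<G = good-part-large {s = suc N} {r} od' 1<d' bound O≡GB B≡1 }
  where
  bound : m + d' < 2 ^ suc N
  bound = <-trans m+d'<N (<-trans (n<1+n N) (n<2^n (suc N)))
  G∣aN : G ∣ a (2 ^ e * d') N
  G∣aN = subst (G ∣_) (sym (a-factor e d' N (suc N + r) 2^N≡))
           (∣-trans (divides B (trans O≡GB (*-comm G B))) (n∣m*n (2 ^ e)))

square≡1 : ∀ {x} → 0 < x → x * x ≡1[mod 1 + x ]
square≡1 {suc y} _ = y , expand y
  where
  expand : ∀ y → suc y * suc y ≡ 1 + (2 + y) * y
  expand = solve-∀

power-index : ∀ t ε m →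
  ∃₂ λ k α → t < k × m ≤ α × 2 ^ k ≡ 2 ^ t * (1 + 2 * ε) + 2 ^ t * (1 + 2 * α)
power-index t ε m = t + suc h , α , t<k , m≤α , (begin
  2 ^ (t + suc h)                          ≡⟨ ^-distribˡ-+-* 2 t (suc h) ⟩
  2 ^ t * (2 * 2 ^ h)                      ≡⟨ cong (λ z → 2 ^ t * (2 * z)) (sym (m+[n∸m]≡n room)) ⟩
  2 ^ t * (2 * (suc ε + α))                ≡⟨ split (2 ^ t) ε α ⟩
  2 ^ t * (1 + 2 * ε) + 2 ^ t * (1 + 2 * α) ∎)
  where
  open ≡-Reasoning
  h = m + ε
  α = 2 ^ h ∸ suc ε
  room : suc ε ≤ 2 ^ h
  room = ≤-trans (s≤s (m≤n+m ε m)) (n<2^n h)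
  t<k : t < t + suc h
  t<k = ≤-trans (s≤s (m≤m+n t h)) (≤-reflexive (sym (+-suc t h)))
  m≤α : m ≤ α
  m≤α = m+n≤o⇒m≤o∸n m (≤-trans (≤-reflexive (+-suc m ε)) (n<2^n h))
  split : ∀ T ε α → T * (2 * (suc ε + α)) ≡ T * (1 + 2 * ε) + T * (1 + 2 * α)
  split = solve-∀

-- Case d = 2^e with e ≥ 1. Write e = 2^t·(1 + 2ε) and take k from power-index, so that
-- 2^k = e + A with A = 2^t·(1 + 2α). Then a_k = 2^e·(1 + 2^A), and G = 1 + 2^A is good
-- at level t + 1 ≤ k because 2^(2^(t+1)·(1 + 2α)) = (2^A)² ≡ 1 (mod G).
power-of-two-case : ∀ {d e} → d ≡ 2 ^ e * 1 → 1 < d → ∀ m → LargeGoodDivisor d m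
power-of-two-case {e = zero}   refl (s≤s ()) m
power-of-two-case {e = suc e₀} refl _        m with two-adic (suc e₀) z<s
... | t , ε , e≡ with power-index t ε m
...   | k , α , t<k , m≤α , 2^k≡ = record
  { N = k ; G = 1 + 2 ^ A ; 0<N = <-≤-trans z<s t<k ; good = good ; G∣aN = G∣aN ; m<G = m<G }
  where
  A = 2 ^ t * (1 + 2 * α)
  double : ∀ T a → 2 * T * a ≡ T * a + T * a
  double = solve-∀
  good : Good k (1 + 2 ^ A)
  good = good-mono t<k (α , refl)
           (≡1-exponent (sym (double (2 ^ t) (1 + 2 * α)))
             (subst (_≡1[mod 1 + 2 ^ A ]) (sym (^-distribˡ-+-* 2 A A)) (square≡1 (m^n>0 2 A))))
  G∣aN : 1 + 2 ^ A ∣ a (2 ^ suc e₀ * 1) k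
  G∣aN = subst (1 + 2 ^ A ∣_) (sym (a-factor (suc e₀) 1 k A (trans 2^k≡ (cong (_+ A) (sym e≡)))))
           (n∣m*n (2 ^ suc e₀))
  m<G : m < 1 + 2 ^ A
  m<G = begin-strict
    m              ≤⟨ m≤α ⟩
    α              ≤⟨ m≤n*m α 2 ⟩
    2 * α          <⟨ n<1+n (2 * α) ⟩
    1 + 2 * α      ≤⟨ m≤n*m (1 + 2 * α) (2 ^ t) {{m^n≢0 2 t}} ⟩
    A              <⟨ n<2^n A ⟩
    2 ^ A          <⟨ n<1+n (2 ^ A) ⟩
    1 + 2 ^ A      ∎
    where open ≤-Reasoning

theorem1 : (d : ℕ) → 1 < d → (m : ℕ) → 0 < m →
    ∃₂ λ k l → 0 < k × 0 < l × k ≢ l × m < gcd (a d k) (a d l)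
theorem1 d 1<d m _ with two-adic d (<-trans z<s 1<d)
... | e , zero  , d≡ = large-gcd (power-of-two-case {e = e} d≡ 1<d m)
... | e , suc δ , d≡ = large-gcd (odd-part-case {e = e} d≡ (suc δ , refl) (s≤s (s≤s z≤n)) m)
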